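{- Let $n$ be a nonnegative integer. There is a delicate overlap-free binary word of length $n$ if and only if $n \geq 7$.
   Context: Words are finite strings over the binary alphabet $\{0,1\}$. A factor of a word is a contiguous subword. An overlap is a word of the form $xYxYx$ where $x$ is a letter and $Y$ is a (possibly empty) word; a word is overlap-free if none of its factors is an overlap. A delicate overlap-free word is a nonempty overlap-free word such that changing any single one of its letters to the other letter of the alphabet yields a word containing an overlap as a factor. -}

module Defs where

open import Data.Bool using (Bool; not)
open import Data.List using (List; []; _∷_; _++_; [_]; length)
open import Data.Fin using (Fin; zero; suc)
open import Data.Product using (Σ; ∃; ∃-syntax; _×_; _,_)
open import Relation.Binary.PropositionalEquality using (_≡_)
open import Relation.Nullary using (¬_)

Word : Set
Word = List Bool

Factor : Word → Word → Set
Factor f w = ∃[ u ] ∃[ v ] (w ≡ u ++ f ++ v)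

Overlap : Word → Set
Overlap f = ∃[ x ] ∃[ Y ] (f ≡ x ∷ (Y ++ x ∷ (Y ++ [ x ])))

HasOverlap : Word → Set
HasOverlap w = ∃[ f ] (Factor f w × Overlap f)

OverlapFree : Word → Set
OverlapFree w = ¬ HasOverlap w

flipAt : (w : Word) → Fin (length w) → Word
flipAt (a ∷ w) zero    = not a ∷ w
flipAt (a ∷ w) (suc i) = a ∷ flipAt w i

NonEmpty : Word → Set
NonEmpty w = ¬ (w ≡ [])

Delicate : Word → Set
Delicate w = NonEmpty w × OverlapFree w × ((i : Fin (length w)) → HasOverlap (flipAt w i))

-- The Thue–Morse word t is overlap-free: an overlap of even period halves to a shorter one, since
-- t (2n) = t n and t (2n + 1) = not (t n); in an overlap of odd period p ≥ 3 the letters at odd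
-- positions 2c + 1, 2c + 3 must differ from their successors (shift by ± p to an even position), which
-- forces t c = t (c + 1) = t (c + 2), impossible.  Flipping the middle letter of any factor of length 9
-- creates an overlap; as t (16 q + r) = t q xor t r, this is a finite check over two adjacent blocks of
-- length 16.  Hence a factor of length n ≥ 9 is delicate as soon as flipping one of its first or last
-- four letters creates an overlap, which a suitable start, depending on n mod 16, achieves.  Lengths 7
-- and 8 have explicit witnesses, and exhaustive search rules out lengths below 7.

module Submission where

open import Defs
open import Data.Bool using (Bool; true; false; not; _xor_)
open import Data.Bool.Properties using (_≟_; xor-identityʳ; not-distribʳ-xor; not-¬; ¬-not; not-injective)
open import Data.Empty using (⊥; ⊥-elim)
open import Data.Fin as Fin using (Fin; toℕ; fromℕ<)
open import Data.Fin.Properties using (all?; toℕ-fromℕ<; toℕ<n)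
open import Data.List using ([]; _∷_; _++_; [_]; length; map; take; drop)
open import Data.List.Properties using (∷-injective; ≡-dec; ++-identityʳ; ++-assoc)
open import Data.Nat using (ℕ; zero; suc; _+_; _∸_; _*_; _^_; _≤_; _<_; _≥_; z≤n; s≤s; s≤s⁻¹; ⌊_/2⌋)
open import Data.Nat.Properties
  using (≤-refl; ≤-trans; <-trans; <⇒≤; <⇒≱; ≮⇒≥; ≰⇒>; n≤1+n; n<1+n; m≤m+n; m<m+n; m≤n⇒m<n∨m≡n;
         m≤n⇒∃[o]m+o≡n; _≤?_; _<?_; +-comm; +-assoc; +-suc; +-identityʳ; m+[n∸m]≡n; m+n≤o⇒m≤o∸n;
         +-mono-≤; +-monoˡ-≤; +-monoʳ-≤; +-monoʳ-<; +-cancelˡ-≤; +-cancelˡ-<; ⌊n/2⌋<n; n≡⌊n+n/2⌋)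
open import Data.Nat.DivMod using (_divMod_; result)
open import Data.Nat.Induction using (<-rec)
open import Data.Nat.Tactic.RingSolver using (solve-∀)
open import Data.Vec using (_∷_; []; lookup)
open import Data.Product using (∃-syntax; _×_; _,_; proj₁; proj₂)
open import Data.Sum using (_⊎_; inj₁; inj₂)
open import Function using (_∘_)
open import Function.Bundles using (_⇔_; mk⇔)
open import Relation.Nullary using (Dec; yes; no; ¬_)
open import Relation.Nullary.Decidable using (map′; _×-dec_; _⊎-dec_; ¬?; toWitness)
open import Relation.Binary.PropositionalEquality
  using (_≡_; _≢_; refl; sym; trans; cong; cong₂; subst; subst₂; module ≡-Reasoning)
open ≡-Reasoning

Splits : (Word → Word → Set) → Word → Set
Splits P w = ∃[ u ] ∃[ v ] (w ≡ u ++ v × P u v)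

splits? : (P : Word → Word → Set) → (∀ u v → Dec (P u v)) → ∀ w → Dec (Splits P w)
splits? P P? [] = map′ (λ p → [] , [] , refl , p) at-nil (P? [] [])
  where
  at-nil : Splits P [] → P [] []
  at-nil ([] , [] , refl , p) = p
splits? P P? (a ∷ w) =
  map′ cons uncons (P? [] (a ∷ w) ⊎-dec splits? (λ u → P (a ∷ u)) (λ u → P? (a ∷ u)) w)
  where
  cons : P [] (a ∷ w) ⊎ Splits (λ u → P (a ∷ u)) w → Splits P (a ∷ w)
  cons (inj₁ p)                = [] , a ∷ w , refl , p
  cons (inj₂ (u , v , eq , p)) = a ∷ u , v , cong (a ∷_) eq , p
  uncons : Splits P (a ∷ w) → P [] (a ∷ w) ⊎ Splits (λ u → P (a ∷ u)) w
  uncons ([] , v , refl , p) = inj₁ p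
  uncons (b ∷ u , v , eq , p) with refl , eq′ ← ∷-injective eq = inj₂ (u , v , eq′ , p)

overlap? : ∀ f → Dec (Overlap f)
overlap? []      = no λ ()
overlap? (x ∷ r) = map′ toOverlap fromOverlap
  (splits? (λ Y Z → Z ≡ x ∷ (Y ++ [ x ])) (λ Y Z → ≡-dec _≟_ Z (x ∷ (Y ++ [ x ]))) r)
  where
  toOverlap : Splits (λ Y Z → Z ≡ x ∷ (Y ++ [ x ])) r → Overlap (x ∷ r)
  toOverlap (Y , _ , eq , refl) = x , Y , cong (x ∷_) eq
  fromOverlap : Overlap (x ∷ r) → Splits (λ Y Z → Z ≡ x ∷ (Y ++ [ x ])) r
  fromOverlap (_ , Y , eq) with refl , eq′ ← ∷-injective eq = Y , _ , eq′ , refl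

hasOverlap? : ∀ w → Dec (HasOverlap w)
hasOverlap? w = map′ toHasOverlap fromHasOverlap
  (splits? (λ _ → Splits (λ f _ → Overlap f)) (λ _ → splits? _ (λ f _ → overlap? f)) w)
  where
  toHasOverlap : Splits (λ _ → Splits (λ f _ → Overlap f)) w → HasOverlap w
  toHasOverlap (u , _ , refl , f , v , refl , ov) = f , (u , v , refl) , ov
  fromHasOverlap : HasOverlap w → Splits (λ _ → Splits (λ f _ → Overlap f)) w
  fromHasOverlap (f , (u , v , eq) , ov) = u , f ++ v , eq , f , v , refl , ov

delicate? : ∀ w → Dec (Delicate w)
delicate? w = ¬? (≡-dec _≟_ w []) ×-dec ¬? (hasOverlap? w) ×-dec all? (λ i → hasOverlap? (flipAt w i))

-- The Thue–Morse sequence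

isOdd : ℕ → Bool
isOdd zero          = false
isOdd (suc zero)    = true
isOdd (suc (suc n)) = isOdd n

-- t n is the parity of the binary digit sum of n.  The first argument of thueMorseWith is
-- fuel; any fuel ≥ n gives the right value.
thueMorseWith : ℕ → ℕ → Bool
thueMorseWith zero    n = false
thueMorseWith (suc f) n = isOdd n xor thueMorseWith f ⌊ n /2⌋

t : ℕ → Bool
t n = thueMorseWith n n

thueMorseWith-0 : ∀ f → thueMorseWith f 0 ≡ false
thueMorseWith-0 zero    = refl
thueMorseWith-0 (suc f) = thueMorseWith-0 f

thueMorseWith-fuel : ∀ f g {n} → n ≤ f → n ≤ g → thueMorseWith f n ≡ thueMorseWith g n
thueMorseWith-fuel zero    g       z≤n _   = sym (thueMorseWith-0 g)
thueMorseWith-fuel (suc f) zero    _   z≤n = thueMorseWith-0 (suc f)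
thueMorseWith-fuel (suc f) (suc g) {n} n≤f n≤g =
  cong (isOdd n xor_) (thueMorseWith-fuel f g (half≤ n≤f) (half≤ n≤g))
  where
  half≤ : ∀ {n f} → n ≤ suc f → ⌊ n /2⌋ ≤ f
  half≤ {zero}  _         = z≤n
  half≤ {suc n} (s≤s n≤f) = ≤-trans (s≤s⁻¹ (⌊n/2⌋<n n)) n≤f

t-unfold : ∀ n → t n ≡ isOdd n xor t ⌊ n /2⌋
t-unfold zero    = refl
t-unfold (suc n) = cong (isOdd (suc n) xor_) (thueMorseWith-fuel n _ (s≤s⁻¹ (⌊n/2⌋<n n)) ≤-refl)

isOdd-double : ∀ a → isOdd (a + a) ≡ false
isOdd-double zero    = refl
isOdd-double (suc a) rewrite +-suc a a = isOdd-double a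

isOdd-double+1 : ∀ a → isOdd (suc (a + a)) ≡ true
isOdd-double+1 zero    = refl
isOdd-double+1 (suc a) rewrite +-suc a a = isOdd-double+1 a

⌊double+1/2⌋ : ∀ a → ⌊ suc (a + a) /2⌋ ≡ a
⌊double+1/2⌋ zero    = refl
⌊double+1/2⌋ (suc a) rewrite +-suc a a = cong suc (⌊double+1/2⌋ a)

t-double : ∀ a → t (a + a) ≡ t a
t-double a = begin
  t (a + a)                        ≡⟨ t-unfold (a + a) ⟩
  isOdd (a + a) xor t ⌊ a + a /2⌋  ≡⟨ cong₂ _xor_ (isOdd-double a) (cong t (sym (n≡⌊n+n/2⌋ a))) ⟩
  t a                              ∎

t-double+1 : ∀ a → t (suc (a + a)) ≡ not (t a)
t-double+1 a = begin
  t (suc (a + a))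
    ≡⟨ t-unfold (suc (a + a)) ⟩
  isOdd (suc (a + a)) xor t ⌊ suc (a + a) /2⌋
    ≡⟨ cong₂ _xor_ (isOdd-double+1 a) (cong t (⌊double+1/2⌋ a)) ⟩
  not (t a)
    ∎

data EvenOdd : ℕ → Set where
  even : ∀ a → EvenOdd (a + a)
  odd  : ∀ a → EvenOdd (suc (a + a))

evenOdd : ∀ n → EvenOdd n
evenOdd zero = even 0
evenOdd (suc n) with evenOdd n
... | even a = odd a
... | odd a  = subst EvenOdd (cong suc (+-suc a a)) (even (suc a))

even≢odd : ∀ c d → c + c ≢ suc (d + d)
even≢odd c d eq = false≢true (trans (sym (isOdd-double c)) (trans (cong isOdd eq) (isOdd-double+1 d)))
  where
  false≢true : false ≢ true
  false≢true ()

t-double≢t-double+1 : ∀ a → t (a + a) ≢ t (suc (a + a))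
t-double≢t-double+1 a eq = not-¬ refl (trans (sym (t-double a)) (trans eq (t-double+1 a)))

t-noThreeEqual : ∀ i → t i ≡ t (suc i) → t (suc i) ≡ t (suc (suc i)) → ⊥
t-noThreeEqual i eq₁ eq₂ with evenOdd i
... | even a = t-double≢t-double+1 a eq₁
... | odd a  = t-double≢t-double+1 (suc a) (subst (λ j → t j ≡ t (suc j)) 2+2a≡1+a+1+a eq₂)
  where
  2+2a≡1+a+1+a : suc (suc (a + a)) ≡ suc a + suc a
  2+2a≡1+a+1+a = cong suc (sym (+-suc a a))

-- The Thue–Morse word is overlap-free

-- t i … t (i + 2p) is an overlap with period p.
OverlapAt : ℕ → ℕ → Set
OverlapAt i p = ∀ k → k ≤ p → t (i + k) ≡ t (i + k + p)

-- Every other letter of an overlap of even period 2a forms an overlap of period a.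
overlapAt-halve : ∀ i a → OverlapAt i (a + a) → ∃[ c ] OverlapAt c a
overlapAt-halve i a ov with evenOdd i
... | even c = c , λ k k≤a → begin
  t (c + k)                         ≡⟨ sym (t-double (c + k)) ⟩
  t ((c + k) + (c + k))             ≡⟨ cong t (sym (lhs c k)) ⟩
  t (c + c + (k + k))               ≡⟨ ov (k + k) (+-mono-≤ k≤a k≤a) ⟩
  t (c + c + (k + k) + (a + a))     ≡⟨ cong t (rhs c k a) ⟩
  t ((c + k + a) + (c + k + a))     ≡⟨ t-double (c + k + a) ⟩
  t (c + k + a)                     ∎
  where
  lhs : ∀ c k → c + c + (k + k) ≡ (c + k) + (c + k)
  lhs = solve-∀
  rhs : ∀ c k a → c + c + (k + k) + (a + a) ≡ (c + k + a) + (c + k + a)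
  rhs = solve-∀
... | odd c = c , λ k k≤a → not-injective (begin
  not (t (c + k))                        ≡⟨ sym (t-double+1 (c + k)) ⟩
  t (suc ((c + k) + (c + k)))            ≡⟨ cong t (sym (lhs c k)) ⟩
  t (suc (c + c) + (k + k))              ≡⟨ ov (k + k) (+-mono-≤ k≤a k≤a) ⟩
  t (suc (c + c) + (k + k) + (a + a))    ≡⟨ cong t (rhs c k a) ⟩
  t (suc ((c + k + a) + (c + k + a)))    ≡⟨ t-double+1 (c + k + a) ⟩
  not (t (c + k + a))                    ∎)
  where
  lhs : ∀ c k → suc (c + c) + (k + k) ≡ suc ((c + k) + (c + k))
  lhs = solve-∀
  rhs : ∀ c k a → suc (c + c) + (k + k) + (a + a) ≡ suc ((c + k + a) + (c + k + a))
  rhs = solve-∀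

odd+odd : ∀ c a → suc (c + c) + suc (a + a) ≡ suc (c + a) + suc (c + a)
odd+odd = solve-∀

odd∸odd-even : ∀ n a c → n + suc (a + a) ≡ suc (c + c) → ∃[ e ] n ≡ e + e
odd∸odd-even n a c eq with evenOdd n
... | even e = e , refl
... | odd d  = ⊥-elim (even≢odd (suc (d + a)) c (trans (sym (odd+odd d a)) eq))

-- In an overlap of odd period p, every odd position m is followed by a different letter,
-- because the letters at m, m + 1 reappear at m ± p, which is even.
overlapAt-oddPeriod-alternates : ∀ i a c → OverlapAt i (suc (a + a)) →
  i ≤ suc (c + c) → suc (suc (c + c)) ≤ i + (suc (a + a) + suc (a + a)) →
  t (suc (c + c)) ≢ t (suc (suc (c + c)))
overlapAt-oddPeriod-alternates i a c ov i≤m m<end eq = alternation evenShift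
  where
  p = suc (a + a)
  m = suc (c + c)

  shifted : ∀ k → suc k ≤ p → t (i + k) ≡ t (i + k + p) × t (suc (i + k)) ≡ t (suc (i + k + p))
  shifted k k<p = ov k (≤-trans (n≤1+n k) k<p)
                , trans (cong t (sym (+-suc i k))) (trans (ov (suc k) k<p) (cong (t ∘ (_+ p)) (+-suc i k)))

  evenShift : ∃[ j ] ((∃[ e ] j ≡ e + e) × t j ≡ t m × t (suc j) ≡ t (suc m))
  evenShift with suc m ≤? i + p
  ... | yes m<i+p = m + p , (suc (c + a) , odd+odd c a) , sym eq₀ , sym eq₁
    where
    k = m ∸ i
    i+k≡m : i + k ≡ m
    i+k≡m = m+[n∸m]≡n i≤m
    k<p : suc k ≤ p
    k<p = +-cancelˡ-≤ i (suc k) p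
            (subst (_≤ i + p) (trans (cong suc (sym i+k≡m)) (sym (+-suc i k))) m<i+p)
    eq₀ = subst (λ j → t j ≡ t (j + p)) i+k≡m (proj₁ (shifted k k<p))
    eq₁ = subst (λ j → t (suc j) ≡ t (suc (j + p))) i+k≡m (proj₂ (shifted k k<p))
  ... | no m≮i+p = i + k , odd∸odd-even (i + k) a c i+k+p≡m , eq₀ , eq₁
    where
    k = m ∸ (i + p)
    i+p+k≡m : i + p + k ≡ m
    i+p+k≡m = m+[n∸m]≡n (s≤s⁻¹ (≰⇒> m≮i+p))
    i+k+p≡m : i + k + p ≡ m
    i+k+p≡m = trans (+-comm-middle i k p) i+p+k≡m
      where
      +-comm-middle : ∀ i k p → i + k + p ≡ i + p + k
      +-comm-middle = solve-∀
    k<p : suc k ≤ p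
    k<p = +-cancelˡ-≤ (i + p) (suc k) p
            (subst₂ _≤_ (trans (cong suc (sym i+p+k≡m)) (sym (+-suc (i + p) k))) (sym (+-assoc i p p)) m<end)
    eq₀ = subst (λ j → t (i + k) ≡ t j) i+k+p≡m (proj₁ (shifted k k<p))
    eq₁ = subst (λ j → t (suc (i + k)) ≡ t (suc j)) i+k+p≡m (proj₂ (shifted k k<p))

  alternation : ∃[ j ] ((∃[ e ] j ≡ e + e) × t j ≡ t m × t (suc j) ≡ t (suc m)) → ⊥
  alternation (_ , (e , refl) , eq₀ , eq₁) = t-double≢t-double+1 e (trans eq₀ (trans eq (sym eq₁)))

t-odd≢next⇒t≡next : ∀ c → t (suc (c + c)) ≢ t (suc (suc (c + c))) → t c ≡ t (suc c)
t-odd≢next⇒t≡next c alternates = not-injective (¬-not λ eq → alternates (begin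
  t (suc (c + c))        ≡⟨ t-double+1 c ⟩
  not (t c)              ≡⟨ eq ⟩
  t (suc c)              ≡⟨ sym (t-double (suc c)) ⟩
  t (suc c + suc c)      ≡⟨ cong (t ∘ suc) (+-suc c c) ⟩
  t (suc (suc (c + c)))  ∎))

halve : ∀ i → ∃[ c ] (c + c ≤ i × i ≤ suc (c + c))
halve i with evenOdd i
... | even c = c , ≤-refl , n≤1+n (c + c)
... | odd c  = c , n≤1+n (c + c) , ≤-refl

-- Two consecutive odd positions 2c + 1, 2c + 3 fit into an overlap of odd period ≥ 3;
-- alternation there makes t c = t (c + 1) = t (c + 2).
overlapAt-oddPeriod : ∀ i a → 1 ≤ a → ¬ OverlapAt i (suc (a + a))
overlapAt-oddPeriod i a@(suc _) _ ov with c , c+c≤i , i≤1+c+c ← halve i =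
  t-noThreeEqual c
    (t-odd≢next⇒t≡next c (overlapAt-oddPeriod-alternates i a c ov
      i≤1+c+c (subst (_≤ end) (c+c+2 c) (within 2 (s≤s (s≤s z≤n))))))
    (t-odd≢next⇒t≡next (suc c) (overlapAt-oddPeriod-alternates i a (suc c) ov
      (≤-trans i≤1+c+c (subst (suc (c + c) ≤_) (c+c+3 c) (m≤m+n _ 2)))
      (subst (_≤ end) (c+c+4 c) (within 4 ≤-refl))))
  where
  p = suc (a + a)
  end = i + (p + p)
  within : ∀ x → x ≤ 4 → c + c + x ≤ end
  within x x≤4 = ≤-trans (+-monoˡ-≤ x c+c≤i)
                   (+-monoʳ-≤ i (≤-trans x≤4 (+-mono-≤ {2} {p} (s≤s (s≤s z≤n)) (s≤s (s≤s z≤n)))))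
  c+c+2 : ∀ c → c + c + 2 ≡ suc (suc (c + c))
  c+c+2 = solve-∀
  c+c+3 : ∀ c → suc (c + c) + 2 ≡ suc (suc c + suc c)
  c+c+3 = solve-∀
  c+c+4 : ∀ c → c + c + 4 ≡ suc (suc (suc c + suc c))
  c+c+4 = solve-∀

overlapAt-period1 : ∀ i → ¬ OverlapAt i 1
overlapAt-period1 i ov =
  t-noThreeEqual i (subst₂ t≡t (i+0 i) (i+0+1 i) (ov 0 z≤n)) (subst₂ t≡t (i+1 i) (i+1+1 i) (ov 1 ≤-refl))
  where
  t≡t : ℕ → ℕ → Set
  t≡t x y = t x ≡ t y
  i+0 : ∀ i → i + 0 ≡ i
  i+0 = solve-∀
  i+0+1 : ∀ i → i + 0 + 1 ≡ suc i
  i+0+1 = solve-∀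
  i+1 : ∀ i → i + 1 ≡ suc i
  i+1 = solve-∀
  i+1+1 : ∀ i → i + 1 + 1 ≡ suc (suc i)
  i+1+1 = solve-∀

t-overlapAt : ∀ p i → 1 ≤ p → ¬ OverlapAt i p
t-overlapAt = <-rec _ λ p rec i 1≤p ov → byParity p i 1≤p rec ov (evenOdd p)
  where
  byParity : ∀ p i → 1 ≤ p → (∀ {q} → q < p → ∀ j → 1 ≤ q → ¬ OverlapAt j q) →
             OverlapAt i p → EvenOdd p → ⊥
  byParity _ i _ rec ov (even (suc a)) with c , ov′ ← overlapAt-halve i (suc a) ov =
    rec (m<m+n (suc a) (s≤s z≤n)) c (s≤s z≤n) ov′
  byParity _ i _ _ ov (odd zero)    = overlapAt-period1 i ov
  byParity _ i _ _ ov (odd (suc a)) = overlapAt-oddPeriod i (suc a) (s≤s z≤n) ov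

tmFactor : ℕ → ℕ → Word
tmFactor s zero    = []
tmFactor s (suc n) = t s ∷ tmFactor (suc s) n

length-tmFactor : ∀ s n → length (tmFactor s n) ≡ n
length-tmFactor s zero    = refl
length-tmFactor s (suc n) = cong suc (length-tmFactor (suc s) n)

tmFactor-++ : ∀ s a m → tmFactor s (a + m) ≡ tmFactor s a ++ tmFactor (s + a) m
tmFactor-++ s zero    m = cong (λ s′ → tmFactor s′ m) (sym (+-identityʳ s))
tmFactor-++ s (suc a) m = cong (t s ∷_) (trans (tmFactor-++ (suc s) a m)
  (cong (λ s′ → tmFactor (suc s) a ++ tmFactor s′ m) (sym (+-suc s a))))

tmFactor-prefix : ∀ s n f v → tmFactor s n ≡ f ++ v → f ≡ tmFactor s (length f)
tmFactor-prefix s n       []      v _  = refl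
tmFactor-prefix s (suc n) (x ∷ f) v eq with refl , eq′ ← ∷-injective eq =
  cong (x ∷_) (tmFactor-prefix (suc s) n f v eq′)

tmFactor-suffix : ∀ s n u v → tmFactor s n ≡ u ++ v → v ≡ tmFactor (s + length u) (length v)
tmFactor-suffix s n []      v eq = trans (tmFactor-prefix s n v [] (trans eq (sym (++-identityʳ v))))
                                         (cong (λ s′ → tmFactor s′ (length v)) (sym (+-identityʳ s)))
tmFactor-suffix s (suc n) (x ∷ u) v eq with refl , eq′ ← ∷-injective eq =
  trans (tmFactor-suffix (suc s) n u v eq′) (cong (λ s′ → tmFactor s′ (length v)) (sym (+-suc s (length u))))

tmFactor-infix : ∀ s n u f v → tmFactor s n ≡ u ++ f ++ v → f ≡ tmFactor (s + length u) (length f)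
tmFactor-infix s n u f v eq = tmFactor-prefix _ _ f v (sym (tmFactor-suffix s n u (f ++ v) eq))

tmFactor-≡⇒t≡ : ∀ i j m → tmFactor i m ≡ tmFactor j m → ∀ k → k < m → t (i + k) ≡ t (j + k)
tmFactor-≡⇒t≡ i j (suc m) eq zero _ with eq₀ , _ ← ∷-injective eq =
  trans (cong t (+-identityʳ i)) (trans eq₀ (cong t (sym (+-identityʳ j))))
tmFactor-≡⇒t≡ i j (suc m) eq (suc k) (s≤s k<m) with _ , eq′ ← ∷-injective eq =
  trans (cong t (+-suc i k)) (trans (tmFactor-≡⇒t≡ (suc i) (suc j) m eq′ k k<m) (cong t (sym (+-suc j k))))

tmFactor-¬overlap : ∀ i m → ¬ Overlap (tmFactor i m)
tmFactor-¬overlap i m (x , Y , eq) = t-overlapAt p i (s≤s z≤n) overlapAt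
  where
  Z = x ∷ Y
  p = length Z
  firstZ : Z ≡ tmFactor i p
  firstZ = tmFactor-prefix i m Z (Z ++ [ x ]) eq
  rest : Z ++ [ x ] ≡ tmFactor (i + p) (length (Z ++ [ x ]))
  rest = tmFactor-suffix i m Z (Z ++ [ x ]) eq
  secondZ : Z ≡ tmFactor (i + p) p
  secondZ = tmFactor-prefix _ _ Z [ x ] (sym rest)
  lastX : [ x ] ≡ tmFactor (i + p + p) 1
  lastX = tmFactor-suffix _ _ Z [ x ] (sym rest)
  overlapAt : OverlapAt i p
  overlapAt k k≤p with m≤n⇒m<n∨m≡n k≤p
  ... | inj₁ k<p = trans (tmFactor-≡⇒t≡ i (i + p) p (trans (sym firstZ) secondZ) k k<p)
                         (cong t (+-comm-middle i p k))
    where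
    +-comm-middle : ∀ i p k → i + p + k ≡ i + k + p
    +-comm-middle = solve-∀
  ... | inj₂ refl = trans (sym (proj₁ (∷-injective secondZ))) (proj₁ (∷-injective lastX))

tmFactor-overlapFree : ∀ s n → OverlapFree (tmFactor s n)
tmFactor-overlapFree s n (f , (u , v , eq) , ov) =
  tmFactor-¬overlap _ _ (subst Overlap (tmFactor-infix s n u f v eq) ov)

2*x≡x+x : ∀ x → 2 * x ≡ x + x
2*x≡x+x = solve-∀

half-< : ∀ {c x} → c + c < x + x → c < x
half-< c+c<x+x = ≰⇒> λ x≤c → <⇒≱ c+c<x+x (+-mono-≤ x≤c x≤c)

t-block : ∀ k q r → r < 2 ^ k → t (q * 2 ^ k + r) ≡ t q xor t r
t-block zero q zero _ = trans (cong t (q*1+0 q)) (sym (xor-identityʳ (t q)))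
  where
  q*1+0 : ∀ q → q * 1 + 0 ≡ q
  q*1+0 = solve-∀
t-block zero q (suc r) (s≤s ())
t-block (suc k) q r r<2x with evenOdd r
... | even c = begin
  t (q * (2 * x) + (c + c))           ≡⟨ cong t (regroup q x c) ⟩
  t ((q * x + c) + (q * x + c))       ≡⟨ t-double (q * x + c) ⟩
  t (q * x + c)                       ≡⟨ t-block k q c (half-< (subst (c + c <_) (2*x≡x+x x) r<2x)) ⟩
  t q xor t c                         ≡⟨ cong (t q xor_) (sym (t-double c)) ⟩
  t q xor t (c + c)                   ∎
  where
  x = 2 ^ k
  regroup : ∀ q x c → q * (2 * x) + (c + c) ≡ (q * x + c) + (q * x + c)
  regroup = solve-∀
... | odd c = begin
  t (q * (2 * x) + suc (c + c))       ≡⟨ cong t (regroup q x c) ⟩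
  t (suc ((q * x + c) + (q * x + c))) ≡⟨ t-double+1 (q * x + c) ⟩
  not (t (q * x + c))                 ≡⟨ cong not (t-block k q c c<x) ⟩
  not (t q xor t c)                   ≡⟨ not-distribʳ-xor (t q) (t c) ⟩
  t q xor not (t c)                   ≡⟨ cong (t q xor_) (sym (t-double+1 c)) ⟩
  t q xor t (suc (c + c))             ∎
  where
  x = 2 ^ k
  c<x = half-< (subst (c + c <_) (2*x≡x+x x) (<-trans (n<1+n _) r<2x))
  regroup : ∀ q x c → q * (2 * x) + suc (c + c) ≡ suc ((q * x + c) + (q * x + c))
  regroup = solve-∀

tmFactor-pointwise : ∀ s s′ n (f : Bool → Bool) →
  (∀ j → j < n → t (s + j) ≡ f (t (s′ + j))) → tmFactor s n ≡ map f (tmFactor s′ n)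
tmFactor-pointwise s s′ zero    f _  = refl
tmFactor-pointwise s s′ (suc n) f eq = cong₂ _∷_
  (subst₂ (λ i i′ → t i ≡ f (t i′)) (+-identityʳ s) (+-identityʳ s′) (eq 0 (s≤s z≤n)))
  (tmFactor-pointwise (suc s) (suc s′) n f λ j j<n →
     subst₂ (λ i i′ → t i ≡ f (t i′)) (+-suc s j) (+-suc s′ j) (eq (suc j) (s≤s j<n)))

tmFactor-block : ∀ k q → tmFactor (q * 2 ^ k) (2 ^ k) ≡ map (t q xor_) (tmFactor 0 (2 ^ k))
tmFactor-block k q = tmFactor-pointwise _ 0 _ (t q xor_) (t-block k q)

take-tmFactor : ∀ s m L → m ≤ L → take m (tmFactor s L) ≡ tmFactor s m
take-tmFactor s zero    L       _         = refl
take-tmFactor s (suc m) (suc L) (s≤s m≤L) = cong (t s ∷_) (take-tmFactor (suc s) m L m≤L)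

drop-tmFactor : ∀ s r L → drop r (tmFactor s L) ≡ tmFactor (s + r) (L ∸ r)
drop-tmFactor s zero    L       = cong (λ s′ → tmFactor s′ L) (sym (+-identityʳ s))
drop-tmFactor s (suc r) zero    = refl
drop-tmFactor s (suc r) (suc L) =
  trans (drop-tmFactor (suc s) r L) (cong (λ s′ → tmFactor s′ (L ∸ r)) (sym (+-suc s r)))

-- Every factor of length ≤ 17 of the Thue–Morse word lies in some (b₀ ⊕ T)(b₁ ⊕ T),
-- where T = t 0 … t 15 and ⊕ is pointwise xor.
twoBlocks : Bool → Bool → Word
twoBlocks b₀ b₁ = map (b₀ xor_) (tmFactor 0 16) ++ map (b₁ xor_) (tmFactor 0 16)

tmFactor-twoBlocks : ∀ q → tmFactor (q * 16) 32 ≡ twoBlocks (t q) (t (suc q))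
tmFactor-twoBlocks q = begin
  tmFactor (q * 16) 32
    ≡⟨ tmFactor-++ (q * 16) 16 16 ⟩
  tmFactor (q * 16) 16 ++ tmFactor (q * 16 + 16) 16
    ≡⟨ cong (λ s → tmFactor (q * 16) 16 ++ tmFactor s 16) (next-block q) ⟩
  tmFactor (q * 16) 16 ++ tmFactor (suc q * 16) 16
    ≡⟨ cong₂ _++_ (tmFactor-block 4 q) (tmFactor-block 4 (suc q)) ⟩
  twoBlocks (t q) (t (suc q))
    ∎
  where
  next-block : ∀ q → q * 16 + 16 ≡ suc q * 16
  next-block = solve-∀

window : Bool → Bool → ℕ → Word
window b₀ b₁ r = take 9 (drop r (twoBlocks b₀ b₁))

tmFactor-window : ∀ q r → 9 + r ≤ 32 → tmFactor (q * 16 + r) 9 ≡ window (t q) (t (suc q)) r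
tmFactor-window q r 9+r≤32 = begin
  tmFactor (q * 16 + r) 9                  ≡⟨ sym (take-tmFactor _ 9 (32 ∸ r) (m+n≤o⇒m≤o∸n 9 9+r≤32)) ⟩
  take 9 (tmFactor (q * 16 + r) (32 ∸ r))  ≡⟨ cong (take 9) (sym (drop-tmFactor (q * 16) r 32)) ⟩
  take 9 (drop r (tmFactor (q * 16) 32))   ≡⟨ cong (take 9 ∘ drop r) (tmFactor-twoBlocks q) ⟩
  window (t q) (t (suc q)) r               ∎

flipAtℕ : Word → ℕ → Word
flipAtℕ []      _       = []
flipAtℕ (a ∷ w) zero    = not a ∷ w
flipAtℕ (a ∷ w) (suc k) = a ∷ flipAtℕ w k

FlipCreatesOverlap : Word → ℕ → Set
FlipCreatesOverlap w j = HasOverlap (flipAtℕ w j)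

flipAt≡flipAtℕ : ∀ w i → flipAt w i ≡ flipAtℕ w (toℕ i)
flipAt≡flipAtℕ (a ∷ w) Fin.zero    = refl
flipAt≡flipAtℕ (a ∷ w) (Fin.suc i) = cong (a ∷_) (flipAt≡flipAtℕ w i)

flipAtℕ-++ʳ : ∀ u v k → flipAtℕ (u ++ v) (length u + k) ≡ u ++ flipAtℕ v k
flipAtℕ-++ʳ []      v k = refl
flipAtℕ-++ʳ (x ∷ u) v k = cong (x ∷_) (flipAtℕ-++ʳ u v k)

flipAtℕ-++ˡ : ∀ u v k → k < length u → flipAtℕ (u ++ v) k ≡ flipAtℕ u k ++ v
flipAtℕ-++ˡ (x ∷ u) v zero    _         = refl
flipAtℕ-++ˡ (x ∷ u) v (suc k) (s≤s k<u) = cong (x ∷_) (flipAtℕ-++ˡ u v k k<u)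

hasOverlap-infix : ∀ u g v → HasOverlap g → HasOverlap (u ++ g ++ v)
hasOverlap-infix u g v (f , (u′ , v′ , refl) , ov) = f , (u ++ u′ , v′ ++ v , reassoc) , ov
  where
  reassoc : u ++ (u′ ++ f ++ v′) ++ v ≡ (u ++ u′) ++ f ++ v′ ++ v
  reassoc = begin
    u ++ (u′ ++ f ++ v′) ++ v     ≡⟨ cong (u ++_) (++-assoc u′ (f ++ v′) v) ⟩
    u ++ u′ ++ (f ++ v′) ++ v     ≡⟨ cong (λ w → u ++ u′ ++ w) (++-assoc f v′ v) ⟩
    u ++ u′ ++ f ++ v′ ++ v       ≡⟨ sym (++-assoc u u′ _) ⟩
    (u ++ u′) ++ f ++ v′ ++ v     ∎

flipAtℕ-window : ∀ s a ℓ e k → k < ℓ → FlipCreatesOverlap (tmFactor (s + a) ℓ) k →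
                 FlipCreatesOverlap (tmFactor s (a + (ℓ + e))) (a + k)
flipAtℕ-window s a ℓ e k k<ℓ ov =
  subst HasOverlap (sym splitting) (hasOverlap-infix u _ (tmFactor (s + a + ℓ) e) ov)
  where
  u = tmFactor s a
  v = tmFactor (s + a) ℓ
  splitting : flipAtℕ (tmFactor s (a + (ℓ + e))) (a + k) ≡ u ++ flipAtℕ v k ++ tmFactor (s + a + ℓ) e
  splitting = begin
    flipAtℕ (tmFactor s (a + (ℓ + e))) (a + k)
      ≡⟨ cong₂ flipAtℕ (tmFactor-++ s a (ℓ + e)) (cong (_+ k) (sym (length-tmFactor s a))) ⟩
    flipAtℕ (u ++ tmFactor (s + a) (ℓ + e)) (length u + k)
      ≡⟨ flipAtℕ-++ʳ u _ k ⟩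
    u ++ flipAtℕ (tmFactor (s + a) (ℓ + e)) k
      ≡⟨ cong (λ w → u ++ flipAtℕ w k) (tmFactor-++ (s + a) ℓ e) ⟩
    u ++ flipAtℕ (v ++ tmFactor (s + a + ℓ) e) k
      ≡⟨ cong (u ++_) (flipAtℕ-++ˡ v _ k (subst (k <_) (sym (length-tmFactor (s + a) ℓ)) k<ℓ)) ⟩
    u ++ flipAtℕ v k ++ tmFactor (s + a + ℓ) e
      ∎

-- Where a position j of a word of length 9 + m sits relative to the windows of length 9:
-- among the first four, in the middle of some window, or among the last four.
data Position (m : ℕ) : ℕ → Set where
  left   : (k : Fin 4) → Position m (toℕ k)
  middle : ∀ a → a ≤ m → Position m (a + 4)
  right  : (k : Fin 4) → Position m (m + (5 + toℕ k))

position : ∀ m j → j < 9 + m → Position m j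
position m j j<9+m with j <? 4
... | yes j<4 = subst (Position m) (toℕ-fromℕ< j<4) (left (fromℕ< j<4))
... | no j≮4 with a , 4+a≡j ← m≤n⇒∃[o]m+o≡n (≮⇒≥ j≮4) with a ≤? m
...   | yes a≤m = subst (Position m) (trans (+-comm a 4) 4+a≡j) (middle a a≤m)
...   | no a≰m with k , 1+m+k≡a ← m≤n⇒∃[o]m+o≡n (≰⇒> a≰m) =
  subst (Position m) (trans (cong (λ k → m + (5 + k)) (toℕ-fromℕ< k<4)) m+5+k≡j) (right (fromℕ< k<4))
  where
  m+5+k≡j : m + (5 + k) ≡ j
  m+5+k≡j = trans (regroup m k) (trans (cong (4 +_) 1+m+k≡a) 4+a≡j)
    where
    regroup : ∀ m k → m + (5 + k) ≡ 4 + (suc m + k)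
    regroup = solve-∀
  k<4 : k < 4
  k<4 = +-cancelˡ-< 5 k 4 (+-cancelˡ-< m (5 + k) (5 + 4)
          (subst₂ _<_ (sym m+5+k≡j) (+-comm 9 m) j<9+m))

∀-Bool? : {P : Bool → Set} → (∀ b → Dec (P b)) → Dec (∀ b → P b)
∀-Bool? P? = map′ (λ { (p , q) true → p ; (p , q) false → q }) (λ h → h true , h false)
                  (P? true ×-dec P? false)

window-middle-flips : (r : Fin 16) (b₀ b₁ : Bool) → FlipCreatesOverlap (window b₀ b₁ (toℕ r)) 4
window-middle-flips = toWitness {a? = all? λ r → ∀-Bool? λ b₀ → ∀-Bool? λ b₁ → hasOverlap? _} _

tmFactor-middle-flips : ∀ N → FlipCreatesOverlap (tmFactor N 9) 4
tmFactor-middle-flips N with result q r N≡r+q*16 ← N divMod 16 =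
  subst (λ w → FlipCreatesOverlap w 4)
    (sym (trans (cong (λ N → tmFactor N 9) (trans N≡r+q*16 (+-comm (toℕ r) (q * 16))))
                (tmFactor-window q (toℕ r) (≤-trans (+-monoʳ-≤ 9 (<⇒≤ (toℕ<n r))) (m≤m+n 25 7)))))
    (window-middle-flips r (t q) (t (suc q)))

LeftFlips : ℕ → Set
LeftFlips s = (k : Fin 4) → FlipCreatesOverlap (tmFactor s 9) (toℕ k)

RightFlips : ℕ → Set
RightFlips r = (k : Fin 4) (b₀ b₁ : Bool) → FlipCreatesOverlap (window b₀ b₁ r) (5 + toℕ k)

-- Found by search: from these starts, flipping one of the first or last four letters creates an
-- overlap too, and the last window stays within two blocks.
start : Fin 16 → ℕ
start = lookup (1 ∷ 0 ∷ 12 ∷ 1 ∷ 0 ∷ 1 ∷ 0 ∷ 0 ∷ 1 ∷ 0 ∷ 10 ∷ 3 ∷ 3 ∷ 1 ∷ 0 ∷ 0 ∷ [])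

start-ends : (r₀ : Fin 16) →
  9 + (start r₀ + toℕ r₀) ≤ 32 × LeftFlips (start r₀) × RightFlips (start r₀ + toℕ r₀)
start-ends = toWitness {a? = all? λ _ →
  (_ ≤? 32) ×-dec all? (λ _ → hasOverlap? _) ×-dec
  all? λ _ → ∀-Bool? λ _ → ∀-Bool? λ _ → hasOverlap? _} _

tmFactor-delicate : ∀ q (r₀ : Fin 16) → Delicate (tmFactor (start r₀) (9 + (q * 16 + toℕ r₀)))
tmFactor-delicate q r₀ = (λ ()) , tmFactor-overlapFree s (9 + m) , λ i →
  subst HasOverlap (sym (flipAt≡flipAtℕ _ i))
    (flips (position m (toℕ i) (subst (toℕ i <_) (length-tmFactor s (9 + m)) (toℕ<n i))))
  where
  s = start r₀
  m = q * 16 + toℕ r₀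
  fits : 9 + (s + toℕ r₀) ≤ 32
  fits = proj₁ (start-ends r₀)
  leftFlips : LeftFlips s
  leftFlips = proj₁ (proj₂ (start-ends r₀))
  rightFlips : RightFlips (s + toℕ r₀)
  rightFlips = proj₂ (proj₂ (start-ends r₀))
  flips : ∀ {j} → Position m j → FlipCreatesOverlap (tmFactor s (9 + m)) j
  flips (left k) =
    flipAtℕ-window s 0 9 m (toℕ k) (≤-trans (toℕ<n k) (m≤m+n 4 5))
      (subst (λ s → FlipCreatesOverlap (tmFactor s 9) (toℕ k)) (sym (+-identityʳ s)) (leftFlips k))
  flips (middle a a≤m) with e , a+e≡m ← m≤n⇒∃[o]m+o≡n a≤m =
    subst (λ n → FlipCreatesOverlap (tmFactor s n) (a + 4)) (trans (regroup a e) (cong (9 +_) a+e≡m))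
      (flipAtℕ-window s a 9 e 4 (m≤m+n 5 4) (tmFactor-middle-flips (s + a)))
    where
    regroup : ∀ a e → a + (9 + e) ≡ 9 + (a + e)
    regroup = solve-∀
  flips (right k) =
    subst (λ n → FlipCreatesOverlap (tmFactor s n) (m + (5 + toℕ k))) (m+9+0 m)
      (flipAtℕ-window s m 9 0 (5 + toℕ k) (+-monoʳ-< 5 (toℕ<n k))
        (subst (λ w → FlipCreatesOverlap w (5 + toℕ k))
          (sym (trans (cong (λ N → tmFactor N 9) (regroup s q (toℕ r₀)))
                      (tmFactor-window q (s + toℕ r₀) fits)))
          (rightFlips k (t q) (t (suc q)))))
    where
    m+9+0 : ∀ m → m + (9 + 0) ≡ 9 + m
    m+9+0 = solve-∀
    regroup : ∀ s q r₀ → s + (q * 16 + r₀) ≡ q * 16 + (s + r₀)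
    regroup = solve-∀

-- Short words

∀-ofLength? : {P : Word → Set} → (∀ w → Dec (P w)) → ∀ n → Dec (∀ w → length w ≡ n → P w)
∀-ofLength? P? zero = map′ (λ { p [] refl → p }) (λ h → h [] refl) (P? [])
∀-ofLength? {P} P? (suc n) =
  map′ extend restrict (∀-ofLength? (λ w → P? (true ∷ w) ×-dec P? (false ∷ w)) n)
  where
  extend : (∀ w → length w ≡ n → P (true ∷ w) × P (false ∷ w)) → ∀ w → length w ≡ suc n → P w
  extend h (true ∷ w)  refl = proj₁ (h w refl)
  extend h (false ∷ w) refl = proj₂ (h w refl)
  restrict : (∀ w → length w ≡ suc n → P w) → ∀ w → length w ≡ n → P (true ∷ w) × P (false ∷ w)
  restrict h w refl = h (true ∷ w) refl , h (false ∷ w) refl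

no-short-delicate : (n : Fin 7) → ∀ w → length w ≡ toℕ n → ¬ Delicate w
no-short-delicate = toWitness {a? = all? λ n → ∀-ofLength? (λ w → ¬? (delicate? w)) (toℕ n)} _

delicate⇒7≤length : ∀ w → Delicate w → 7 ≤ length w
delicate⇒7≤length w del with 7 ≤? length w
... | yes 7≤∣w∣ = 7≤∣w∣
... | no 7≰∣w∣  = ⊥-elim (no-short-delicate (fromℕ< ∣w∣<7) w (sym (toℕ-fromℕ< ∣w∣<7)) del)
  where
  ∣w∣<7 = ≰⇒> 7≰∣w∣

delicate-of-length-7+ : ∀ e → ∃[ w ] (length w ≡ 7 + e × Delicate w)
delicate-of-length-7+ 0 = w , refl , toWitness {a? = delicate? w} _
  where
  w = false ∷ false ∷ true ∷ false ∷ true ∷ true ∷ false ∷ []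
delicate-of-length-7+ 1 = w , refl , toWitness {a? = delicate? w} _
  where
  w = false ∷ true ∷ true ∷ false ∷ true ∷ false ∷ false ∷ true ∷ []
delicate-of-length-7+ (suc (suc m)) with result q r₀ m≡r₀+q*16 ← m divMod 16 =
  tmFactor (start r₀) (9 + m) , length-tmFactor _ _ ,
  subst (λ m → Delicate (tmFactor (start r₀) (9 + m))) (sym (trans m≡r₀+q*16 (+-comm (toℕ r₀) _)))
    (tmFactor-delicate q r₀)

theorem4 : (n : ℕ) → (∃[ w ] (length w ≡ n × Delicate w)) ⇔ (n ≥ 7)
theorem4 n = mk⇔ (λ { (w , refl , del) → delicate⇒7≤length w del }) λ 7≤n →
  let e , 7+e≡n = m≤n⇒∃[o]m+o≡n 7≤n in
  subst (λ n → ∃[ w ] (length w ≡ n × Delicate w)) 7+e≡n (delicate-of-length-7+ e)
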